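{- For every natural number $n$, there is precisely one positive CS $n$-set whose elements are pairwise distinct.
   Context: A CS-set is a finite multiset $\langle a_1,\dots,a_n\rangle$ of integers (repeated elements allowed, order irrelevant) such that $a_1^3+a_2^3+\cdots+a_n^3=(a_1+a_2+\cdots+a_n)^2$, where it is required that no $a_i$ equals $0$ and that the multiset does not contain both $k$ and $-k$ for any integer $k$. A CS $n$-set is a CS-set with exactly $n$ elements (counted with multiplicity). A positive CS-set is one all of whose entries are positive integers. -}

module Defs where

open import Data.Nat using (ℕ)
open import Data.Integer using (ℤ; +_; -_; _+_; _*_; _<_; _^_)
open import Data.List using (List; []; _∷_; length; map; foldr)
open import Data.List.Membership.Propositional using (_∈_; _∉_)
open import Data.List.Relation.Unary.All using (All)
open import Data.List.Relation.Unary.Unique.Propositional using (Unique)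
open import Data.List.Relation.Binary.Permutation.Propositional using (_↭_)
open import Data.Product using (_×_; Σ; ∃)
open import Relation.Binary.PropositionalEquality using (_≡_; _≢_)

-- A finite multiset of integers is represented by a list; two lists
-- represent the same multiset iff they are permutations of one another (_↭_).

sumℤ : List ℤ → ℤ
sumℤ = foldr _+_ (+ 0)

sumCubes : List ℤ → ℤ
sumCubes xs = sumℤ (map (λ a → a ^ 3) xs)

record IsCSSet (xs : List ℤ) : Set where
  field
    nonzero   : All (λ a → a ≢ + 0) xs
    noOpposite : All (λ a → (- a) ∉ xs) xs
    cubeEq    : sumCubes xs ≡ (sumℤ xs) ^ 2

IsCSnSet : ℕ → List ℤ → Set
IsCSnSet n xs = IsCSSet xs × length xs ≡ n

Positive : List ℤ → Set
Positive xs = All (λ a → + 0 < a) xs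

IsDistinctPosCSnSet : ℕ → List ℤ → Set
IsDistinctPosCSnSet n xs = IsCSnSet n xs × Positive xs × Unique xs

{-# OPTIONS --safe #-}
module Submission where

-- For distinct positive integers bounded by N one has 2 Σ a ≤ N (N + 1) and (Σ a)² ≤ Σ a³,
-- by induction on N, splitting off N when it occurs: if s is the sum of the others, then
-- (N + s)² = N² + N · 2s + s² ≤ N² + N · (N − 1) N + Σ a³ = N³ + Σ a³ (sums over the others).
-- Equality in the second bound forces equality in the first, i.e. the others are 1, …, N − 1.
-- Hence {1, …, n}, a CS-set by Nicomachus' identity, is the only distinct positive CS n-set.

open import Defs
open import Data.Nat using (ℕ)
open import Data.Integer using (ℤ)
open import Data.List using (List)
open import Data.List.Relation.Binary.Permutation.Propositional using (_↭_)
open import Data.Product using (_×_; ∃)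

open import Data.Nat using (zero; suc; _+_; _*_; _^_; _≤_; _<_; z≤n; s≤s; z<s; _≟_)
import Data.Nat.Properties as ℕ
open import Data.Nat.ListAction using (sum)
open import Data.Nat.ListAction.Properties using (sum-↭)
open import Data.Nat.Solver using (module +-*-Solver)
open +-*-Solver using (solve; _:+_; _:*_; _:^_; _:=_; con)
import Data.Integer as ℤ
open import Data.Integer using (+_)
import Data.Integer.Properties as ℤ
open import Data.List using ([]; _∷_; map; length; applyDownFrom)
open import Data.List.Properties using (length-map; length-applyDownFrom; map-applyDownFrom)
open import Data.List.Membership.Propositional using (_∉_)
open import Data.List.Membership.Propositional.Properties using (∈-map⁻)
open import Data.List.Relation.Unary.All as All using (All; []; _∷_)
open import Data.List.Relation.Unary.All.Properties using (applyDownFrom⁺₂; gmap⁺)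
open import Data.List.Relation.Unary.AllPairs using ([]; _∷_)
open import Data.List.Relation.Unary.Unique.Propositional using (Unique)
import Data.List.Relation.Unary.Unique.Propositional.Properties as Unique
open import Data.List.Relation.Binary.Permutation.Propositional using (↭-refl; ↭-trans; prep; swap)
open import Data.List.Relation.Binary.Permutation.Propositional.Properties
  using (All-resp-↭; ↭-length) renaming (map⁺ to ↭-map⁺)
open import Data.Product using (_,_)
open import Data.Sum using (inj₁; inj₂)
open import Data.Empty using (⊥-elim)
open import Function using (id)
open import Relation.Nullary using (yes; no)
open import Relation.Binary.PropositionalEquality
  using (_≡_; _≢_; refl; sym; trans; cong; cong₂; subst; ≢-sym; module ≡-Reasoning)

countdown : ℕ → List ℕ
countdown = applyDownFrom suc

cubes : List ℕ → ℕ
cubes ns = sum (map (_^ 3) ns)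

InRange : ℕ → ℕ → Set
InRange N a = 0 < a × a ≤ N

≤∧≤∧+≡⇒≡ : ∀ {a b c d} → a ≤ b → c ≤ d → a + c ≡ b + d → a ≡ b
≤∧≤∧+≡⇒≡ a≤b c≤d eq with ℕ.m≤n⇒m<n∨m≡n a≤b
... | inj₂ a≡b = a≡b
... | inj₁ a<b = ⊥-elim (ℕ.<⇒≢ (ℕ.+-mono-<-≤ a<b c≤d) eq)

triangle-suc : ∀ N → 2 * suc N + N * suc N ≡ suc N * suc (suc N)
triangle-suc = solve 1 (λ n → con 2 :* (con 1 :+ n) :+ n :* (con 1 :+ n)
                         := (con 1 :+ n) :* (con 2 :+ n)) refl

data TopView (N : ℕ) (ns : List ℕ) : Set where
  absent  : All (InRange N) ns → TopView N ns
  present : ∀ rest → ns ↭ suc N ∷ rest → Unique rest → All (InRange N) rest → TopView N ns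

InRange-pred : ∀ {N a} → suc N ≢ a → InRange (suc N) a → InRange N a
InRange-pred N≢a (0<a , a≤N) = 0<a , ℕ.≤-pred (ℕ.≤∧≢⇒< a≤N (≢-sym N≢a))

topView : ∀ N {ns} → Unique ns → All (InRange (suc N)) ns → TopView N ns
topView N [] [] = absent []
topView N {a ∷ ns} (a∉ns ∷ u) (ba ∷ b) with a ≟ suc N | topView N u b
... | yes refl | _ = present ns ↭-refl u (All.zipWith (λ (ne , r) → InRange-pred ne r) (a∉ns , b))
... | no a≢N | absent b′ = absent (InRange-pred (≢-sym a≢N) ba ∷ b′)
... | no a≢N | present rest p u′ b′ =
  present (a ∷ rest) (↭-trans (prep a p) (swap a (suc N) ↭-refl))
    (All.tail (All-resp-↭ p a∉ns) ∷ u′) (InRange-pred (≢-sym a≢N) ba ∷ b′)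

double-sum-≤ : ∀ N {ns} → Unique ns → All (InRange N) ns → 2 * sum ns ≤ N * suc N
double-sum-≤ zero _ [] = z≤n
double-sum-≤ zero _ ((s≤s _ , ()) ∷ _)
double-sum-≤ (suc N) {ns} u b with topView N u b
... | absent b′ = ℕ.≤-trans (double-sum-≤ N u b′) (ℕ.*-mono-≤ (ℕ.n≤1+n N) (ℕ.n≤1+n (suc N)))
... | present rest p u′ b′ = begin
  2 * sum ns               ≡⟨ cong (2 *_) (sum-↭ p) ⟩
  2 * (suc N + sum rest)   ≡⟨ ℕ.*-distribˡ-+ 2 (suc N) (sum rest) ⟩
  2 * suc N + 2 * sum rest ≤⟨ ℕ.+-monoʳ-≤ (2 * suc N) (double-sum-≤ N u′ b′) ⟩
  2 * suc N + N * suc N    ≡⟨ triangle-suc N ⟩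
  suc N * suc (suc N)      ∎
  where open ℕ.≤-Reasoning

double-sum-≡⇒↭countdown : ∀ N {ns} → Unique ns → All (InRange N) ns →
                          2 * sum ns ≡ N * suc N → ns ↭ countdown N
double-sum-≡⇒↭countdown zero _ [] _ = ↭-refl
double-sum-≡⇒↭countdown zero _ ((s≤s _ , ()) ∷ _)
double-sum-≡⇒↭countdown (suc N) {ns} u b eq with topView N u b
... | absent b′ = ⊥-elim (ℕ.<⇒≢ (ℕ.≤-<-trans (double-sum-≤ N u b′) triangle-<) eq)
  where
  triangle-< : N * suc N < suc N * suc (suc N)
  triangle-< = subst (N * suc N <_) (triangle-suc N) (ℕ.m<n+m (N * suc N) z<s)
... | present rest p u′ b′ =
  ↭-trans p (prep (suc N) (double-sum-≡⇒↭countdown N u′ b′ (ℕ.+-cancelˡ-≡ (2 * suc N) _ _ eq′)))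
  where
  open ≡-Reasoning
  eq′ : 2 * suc N + 2 * sum rest ≡ 2 * suc N + N * suc N
  eq′ = begin
    2 * suc N + 2 * sum rest ≡⟨ sym (ℕ.*-distribˡ-+ 2 (suc N) (sum rest)) ⟩
    2 * (suc N + sum rest)   ≡⟨ cong (2 *_) (sym (sum-↭ p)) ⟩
    2 * sum ns               ≡⟨ eq ⟩
    suc N * suc (suc N)      ≡⟨ sym (triangle-suc N) ⟩
    2 * suc N + N * suc N    ∎

square-sum-split : ∀ {M ns} rest → ns ↭ M ∷ rest →
                   sum ns ^ 2 ≡ M ^ 2 + M * (2 * sum rest) + sum rest ^ 2
square-sum-split {M} rest p =
  trans (cong (_^ 2) (sum-↭ p)) (square-expand M (sum rest))
  where
  square-expand : ∀ m s → (m + s) ^ 2 ≡ m ^ 2 + m * (2 * s) + s ^ 2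
  square-expand = solve 2 (λ m s → (m :+ s) :^ 2 := m :^ 2 :+ m :* (con 2 :* s) :+ s :^ 2) refl

cubes-split : ∀ {N ns} rest → ns ↭ suc N ∷ rest →
              cubes ns ≡ suc N ^ 2 + suc N * (N * suc N) + cubes rest
cubes-split {N} rest p =
  trans (sum-↭ (↭-map⁺ (_^ 3) p)) (cong (_+ cubes rest) (cube-suc N))
  where
  cube-suc : ∀ n → suc n ^ 3 ≡ suc n ^ 2 + suc n * (n * suc n)
  cube-suc = solve 1 (λ n → (con 1 :+ n) :^ 3
                         := (con 1 :+ n) :^ 2 :+ (con 1 :+ n) :* (n :* (con 1 :+ n))) refl

sum²≤cubes : ∀ N {ns} → Unique ns → All (InRange N) ns → sum ns ^ 2 ≤ cubes ns
sum²≤cubes zero _ [] = z≤n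
sum²≤cubes zero _ ((s≤s _ , ()) ∷ _)
sum²≤cubes (suc N) {ns} u b with topView N u b
... | absent b′ = sum²≤cubes N u b′
... | present rest p u′ b′ = begin
  sum ns ^ 2                                ≡⟨ square-sum-split rest p ⟩
  M ^ 2 + M * (2 * sum rest) + sum rest ^ 2 ≤⟨ ℕ.+-mono-≤ (ℕ.+-monoʳ-≤ (M ^ 2) 2s≤NM) (sum²≤cubes N u′ b′) ⟩
  M ^ 2 + M * (N * M) + cubes rest          ≡⟨ sym (cubes-split rest p) ⟩
  cubes ns                                  ∎
  where
  M = suc N
  2s≤NM : M * (2 * sum rest) ≤ M * (N * M)
  2s≤NM = ℕ.*-monoʳ-≤ M (double-sum-≤ N u′ b′)
  open ℕ.≤-Reasoning

↭countdown⇒↭countdown-length : ∀ {ns m} → ns ↭ countdown m → ns ↭ countdown (length ns)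
↭countdown⇒↭countdown-length {m = m} p rewrite ↭-length p | length-applyDownFrom suc m = p

cubes≡sum²⇒↭countdown : ∀ N {ns} → Unique ns → All (InRange N) ns →
                        cubes ns ≡ sum ns ^ 2 → ns ↭ countdown (length ns)
cubes≡sum²⇒↭countdown zero _ [] _ = ↭-refl
cubes≡sum²⇒↭countdown zero _ ((s≤s _ , ()) ∷ _)
cubes≡sum²⇒↭countdown (suc N) {ns} u b eq with topView N u b
... | absent b′ = cubes≡sum²⇒↭countdown N u b′ eq
... | present rest p u′ b′ =
  ↭countdown⇒↭countdown-length (↭-trans p (prep M (double-sum-≡⇒↭countdown N u′ b′ 2s≡NM)))
  where
  M = suc N
  tight : M ^ 2 + M * (2 * sum rest) ≡ M ^ 2 + M * (N * M)
  tight = ≤∧≤∧+≡⇒≡ (ℕ.+-monoʳ-≤ (M ^ 2) (ℕ.*-monoʳ-≤ M (double-sum-≤ N u′ b′))) (sum²≤cubes N u′ b′)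
                   (trans (sym (square-sum-split rest p)) (trans (sym eq) (cubes-split rest p)))
  2s≡NM : 2 * sum rest ≡ N * M
  2s≡NM = ℕ.*-cancelˡ-≡ _ _ M (ℕ.+-cancelˡ-≡ (M ^ 2) _ _ tight)

All-≤-sum : ∀ ns → All (_≤ sum ns) ns
All-≤-sum [] = []
All-≤-sum (n ∷ ns) =
  ℕ.m≤m+n n (sum ns) ∷ All.map (λ a≤ → ℕ.≤-trans a≤ (ℕ.m≤n+m (sum ns) n)) (All-≤-sum ns)

positive-cubes≡sum²⇒↭countdown : ∀ {ns} → All (0 <_) ns → Unique ns →
                                 cubes ns ≡ sum ns ^ 2 → ns ↭ countdown (length ns)
positive-cubes≡sum²⇒↭countdown {ns} pos u =
  cubes≡sum²⇒↭countdown (sum ns) u (All.zip (pos , All-≤-sum ns))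

double-sum-countdown : ∀ n → 2 * sum (countdown n) ≡ n * suc n
double-sum-countdown zero = refl
double-sum-countdown (suc n) = begin
  2 * (suc n + sum (countdown n))   ≡⟨ ℕ.*-distribˡ-+ 2 (suc n) _ ⟩
  2 * suc n + 2 * sum (countdown n) ≡⟨ cong (λ t → 2 * suc n + t) (double-sum-countdown n) ⟩
  2 * suc n + n * suc n             ≡⟨ triangle-suc n ⟩
  suc n * suc (suc n)               ∎
  where open ≡-Reasoning

cubes-countdown : ∀ n → cubes (countdown n) ≡ sum (countdown n) ^ 2
cubes-countdown zero = refl
cubes-countdown (suc n) = begin
  cubes (countdown M)
    ≡⟨ cubes-split (countdown n) unfold ⟩
  M ^ 2 + M * (n * M) + cubes (countdown n)
    ≡⟨ cong₂ (λ t c → M ^ 2 + M * t + c) (sym (double-sum-countdown n)) (cubes-countdown n) ⟩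
  M ^ 2 + M * (2 * sum (countdown n)) + sum (countdown n) ^ 2
    ≡⟨ sym (square-sum-split (countdown n) unfold) ⟩
  sum (countdown M) ^ 2
    ∎
  where
  M = suc n
  unfold : countdown M ↭ M ∷ countdown n
  unfold = ↭-refl
  open ≡-Reasoning

Unique-countdown : ∀ n → Unique (countdown n)
Unique-countdown n =
  subst Unique (map-applyDownFrom id suc n) (Unique.map⁺ ℕ.suc-injective (Unique.downFrom⁺ n))

pos-^ : ∀ a k → (+ a) ℤ.^ k ≡ + (a ^ k)
pos-^ a zero = refl
pos-^ a (suc k) = trans (cong ((+ a) ℤ.*_) (pos-^ a k)) (sym (ℤ.pos-* a (a ^ k)))

sumℤ-map-+ : ∀ ns → sumℤ (map +_ ns) ≡ + sum ns
sumℤ-map-+ [] = refl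
sumℤ-map-+ (n ∷ ns) = trans (cong (ℤ._+_ (+ n)) (sumℤ-map-+ ns)) (sym (ℤ.pos-+ n (sum ns)))

sumCubes-map-+ : ∀ ns → sumCubes (map +_ ns) ≡ + cubes ns
sumCubes-map-+ [] = refl
sumCubes-map-+ (n ∷ ns) =
  trans (cong₂ ℤ._+_ (pos-^ n 3) (sumCubes-map-+ ns)) (sym (ℤ.pos-+ (n ^ 3) (cubes ns)))

square-sumℤ-map-+ : ∀ ns → sumℤ (map +_ ns) ℤ.^ 2 ≡ + (sum ns ^ 2)
square-sumℤ-map-+ ns = trans (cong (ℤ._^ 2) (sumℤ-map-+ ns)) (pos-^ (sum ns) 2)

cubeEq-map-+⇒ : ∀ ns → sumCubes (map +_ ns) ≡ sumℤ (map +_ ns) ℤ.^ 2 → cubes ns ≡ sum ns ^ 2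
cubeEq-map-+⇒ ns eq = ℤ.+-injective (trans (sym (sumCubes-map-+ ns)) (trans eq (square-sumℤ-map-+ ns)))

cubeEq-map-+⇐ : ∀ ns → cubes ns ≡ sum ns ^ 2 → sumCubes (map +_ ns) ≡ sumℤ (map +_ ns) ℤ.^ 2
cubeEq-map-+⇐ ns eq = trans (sumCubes-map-+ ns) (trans (cong +_ eq) (sym (square-sumℤ-map-+ ns)))

-pos∉map-+ : ∀ {a ms} → 0 < a → ℤ.- (+ a) ∉ map +_ ms
-pos∉map-+ (s≤s _) x∈ with ∈-map⁻ +_ x∈
... | _ , _ , ()

IsCSSet-map-+ : ∀ {ns} → All (0 <_) ns → cubes ns ≡ sum ns ^ 2 → IsCSSet (map +_ ns)
IsCSSet-map-+ {ns} pos eq = record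
  { nonzero    = gmap⁺ (λ 0<a a≡0 → ℕ.<⇒≢ 0<a (sym (ℤ.+-injective a≡0))) pos
  ; noOpposite = gmap⁺ -pos∉map-+ pos
  ; cubeEq     = cubeEq-map-+⇐ ns eq
  }

Positive⇒≡map-+ : ∀ {xs} → Positive xs → ∃ λ ns → xs ≡ map +_ ns × All (0 <_) ns
Positive⇒≡map-+ [] = [] , refl , []
Positive⇒≡map-+ (ℤ.+<+ 0<n ∷ ps) with Positive⇒≡map-+ ps
... | ns , refl , pos = _ ∷ ns , refl , 0<n ∷ pos

countdown-isDistinctPosCSnSet : ∀ n → IsDistinctPosCSnSet n (map +_ (countdown n))
countdown-isDistinctPosCSnSet n =
  (IsCSSet-map-+ pos (cubes-countdown n) , trans (length-map +_ (countdown n)) (length-applyDownFrom suc n))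
  , gmap⁺ ℤ.+<+ pos
  , Unique.map⁺ ℤ.+-injective (Unique-countdown n)
  where
  pos : All (0 <_) (countdown n)
  pos = applyDownFrom⁺₂ suc n (λ _ → z<s)

proposition3 : (n : ℕ) → ∃ λ (xs : List ℤ) → IsDistinctPosCSnSet n xs
    × ((ys : List ℤ) → IsDistinctPosCSnSet n ys → ys ↭ xs)
proposition3 n = map +_ (countdown n) , countdown-isDistinctPosCSnSet n , unique
  where
  unique : (ys : List ℤ) → IsDistinctPosCSnSet n ys → ys ↭ map +_ (countdown n)
  unique ys ((cs , |ys|≡n) , pos , u) with Positive⇒≡map-+ pos
  ... | ns , refl , ns>0 = ↭-map⁺ +_ (subst (λ m → ns ↭ countdown m) |ns|≡n ns↭countdown)
    where
    ns↭countdown : ns ↭ countdown (length ns)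
    ns↭countdown = positive-cubes≡sum²⇒↭countdown ns>0 (Unique.map⁻ u)
                     (cubeEq-map-+⇒ ns (IsCSSet.cubeEq cs))
    |ns|≡n : length ns ≡ n
    |ns|≡n = trans (sym (length-map +_ ns)) |ys|≡n
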